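{- Let $q>1$ be an odd prime power, $n\ge1$, and $r_1,\dots,r_n$ positive integers. Let $\beta$ be an odd integer with $\beta\ge 0$, suppose $\sum_j r_j$ is even and $\beta\le\sum_j r_j-2$, and let $L=(\sum_j r_j-1-\beta)/2$. Then $$\Phi_\beta(\vec r)=-\sum_{\substack{I\subseteq\{1,\dots,n\}\\ \sigma(I)\le L}}(-1)^{|I|}.$$
   Context: For $I\subseteq\{1,\dots,n\}$ let $\sigma(I)=\sum_{i\in I}r_i$ and $|I|$ its cardinality. For an integer $\delta\ge0$ define $\phi_\delta(\vec r)=\sum_{I\subseteq\{1,\dots,n\},\ \sigma(I)\le\delta}(-1)^{|I|}q^{ -\sigma(I)}$ (equivalently $\sum_{D\mid P_1\cdots P_n,\ \deg D\le\delta}\mu(D)q^{ -\deg D}$ for distinct monic primes $P_j\in\mathbb F_q[x]$ of degree $r_j$). With $2L=\sum r_j-1-\beta$, define $\Phi_\beta(\vec r)=-q^L\phi_L(\vec r)+(q-1)\sum_{l=0}^{L-1}q^l\phi_l(\vec r)$. -}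

module Defs where

open import Data.Nat as ℕ using (ℕ; zero; suc; _≤_; _≤?_; NonZero; _∸_)
open import Data.Nat.Properties using (m^n≢0)
open import Data.Nat.DivMod using (_/_)
open import Data.Nat.Divisibility using (_∣_)
open import Data.Nat.Primality using (Prime)
open import Data.Integer using (+_; -[1+_])
open import Data.Rational as Q using (ℚ; 0ℚ; 1ℚ; normalize; _+_; _*_; -_; _-_)
open import Data.Fin using (Fin)
open import Data.Fin.Subset using (Subset; inside; outside; ∣_∣)
open import Data.Vec using (Vec; []; _∷_)
open import Data.List using (List; []; _∷_; [_]; map; _++_; filter; foldr; upTo)
open import Data.Product using (Σ; _×_)
open import Data.Bool using (true; false)
open import Relation.Nullary using (¬_)

OddPrimePower : ℕ → Set
OddPrimePower q = Σ ℕ λ p → Σ ℕ λ k → Prime p × 1 ≤ k × q ≡ p ℕ.^ k × ¬ (2 ∣ q)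
  where open import Relation.Binary.PropositionalEquality using (_≡_)

sumℚ : List ℚ → ℚ
sumℚ = foldr _+_ 0ℚ

_^ℚ_ : ℚ → ℕ → ℚ
x ^ℚ zero  = 1ℚ
x ^ℚ suc k = x * (x ^ℚ k)

ℕtoℚ : ℕ → ℚ
ℕtoℚ m = normalize m 1

qinv : (q : ℕ) → .{{NonZero q}} → ℕ → ℚ
qinv q k = normalize 1 (q ℕ.^ k) {{m^n≢0 q k}}

subsets : (n : ℕ) → List (Subset n)
subsets zero    = [ [] ]
subsets (suc n) = map (inside ∷_) (subsets n) ++ map (outside ∷_) (subsets n)

σ : ∀ {n} → Vec ℕ n → Subset n → ℕ
σ []       []            = 0
σ (r ∷ rs) (inside ∷ I)  = r ℕ.+ σ rs I
σ (r ∷ rs) (outside ∷ I) = σ rs I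

subsetsBelow : ∀ {n} → Vec ℕ n → ℕ → List (Subset n)
subsetsBelow {n} r δ = filter (λ I → σ r I ≤? δ) (subsets n)

φ : (q : ℕ) → .{{NonZero q}} → ∀ {n} → ℕ → Vec ℕ n → ℚ
φ q δ r = sumℚ (map (λ I → ((- 1ℚ) ^ℚ ∣ I ∣) * qinv q (σ r I)) (subsetsBelow r δ))

total : ∀ {n} → Vec ℕ n → ℕ
total []       = 0
total (x ∷ xs) = x ℕ.+ total xs

Lof : ∀ {n} → ℕ → Vec ℕ n → ℕ
Lof β r = (total r ∸ 1 ∸ β) / 2

Φ : (q : ℕ) → .{{NonZero q}} → ∀ {n} → ℕ → Vec ℕ n → ℚ
Φ q β r =
  (- ((ℕtoℚ q ^ℚ L) * φ q L r))
  + ((ℕtoℚ q - 1ℚ) * sumℚ (map (λ l → (ℕtoℚ q ^ℚ l) * φ q l r) (upTo L)))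
  where L = Lof β r

signSum : ∀ {n} → Vec ℕ n → ℕ → ℚ
signSum r δ = sumℚ (map (λ I → (- 1ℚ) ^ℚ ∣ I ∣) (subsetsBelow r δ))

{-# OPTIONS --safe #-}
-- Grouping the subsets I by σ(I) = k into the level sums λ_k = Σ_{σ(I) = k} (-1)^{|I|} gives
-- φ_δ = Σ_{k ≤ δ} λ_k q^{-k}, hence q^{δ+1} (φ_{δ+1} - φ_δ) = λ_{δ+1}.  With this, the sum
-- (q - 1) Σ_{l<L} q^l φ_l telescopes against q^L φ_L, leaving -Σ_{k ≤ L} λ_k.  The identity holds
-- for every L and every q ≠ 0.
module Submission where

open import Defs
open import Data.Nat using (ℕ; NonZero; _≤_; _+_; _≥_)
open import Data.Nat.Divisibility using (_∣_)
open import Data.Vec using (Vec; lookup)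
open import Data.Fin using (Fin)
open import Relation.Nullary using (¬_)
open import Relation.Binary.PropositionalEquality using (_≡_)
open import Data.Rational using (-_)

open import Data.Nat as ℕ using (zero; suc; _≤?_; _≟_)
open import Data.Nat.Properties
  using (<-cmp; ≤-pred; <⇒≤; ≤-reflexive; <-trans; n<1+n; <⇒≢; >⇒≢; <⇒≱; ≤⇒≯; n≤0⇒n≡0; m^n≢0)
open import Data.Nat.Coprimality using (1-coprimeTo) renaming (sym to coprime-sym)
open import Data.Integer as ℤ using ()
open import Data.Integer.Properties using (pos-*)
open import Data.Rational using (ℚ; mkℚ; 0ℚ; 1ℚ; normalize; _*_; _-_) renaming (_+_ to _+ℚ_)
open import Data.Rational.Properties
  using (normalize-coprime; toℚᵘ-injective; toℚᵘ-homo-*; *-inverseʳ; +-identityˡ; +-identityʳ; +-assoc;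
         *-zeroˡ; *-identityʳ; *-distribʳ-+)
open import Data.Rational.Unnormalised using (*≡*)
open import Data.Rational.Unnormalised.Properties using (≃-trans)
open import Data.Rational.Solver using (module +-*-Solver)
open import Data.Fin.Subset using (Subset; ∣_∣)
open import Data.List using (List; []; _∷_; [_]; map; _++_; filter; upTo)
open import Data.List.Properties using (map-++; filter-accept; filter-reject; upTo-∷ʳ)
open import Data.List.Relation.Unary.All as All using (All; []; _∷_)
open import Data.List.Relation.Unary.All.Properties using (all-filter)
open import Relation.Binary.PropositionalEquality using (refl; sym; trans; cong; cong₂; module ≡-Reasoning)
open import Relation.Binary.Definitions using (tri<; tri≈; tri>)
open import Function using (_∘_)
open ≡-Reasoning
open +-*-Solver

ℕtoℚ≡mkℚ : ∀ m → ℕtoℚ m ≡ mkℚ (ℤ.+ m) 0 (coprime-sym (1-coprimeTo m))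
ℕtoℚ≡mkℚ m = normalize-coprime (coprime-sym (1-coprimeTo m))

ℕtoℚ-homo-* : ∀ a b → ℕtoℚ a * ℕtoℚ b ≡ ℕtoℚ (a ℕ.* b)
ℕtoℚ-homo-* a b rewrite ℕtoℚ≡mkℚ a | ℕtoℚ≡mkℚ b | ℕtoℚ≡mkℚ (a ℕ.* b) =
  toℚᵘ-injective (≃-trans (toℚᵘ-homo-* (mkℚ (ℤ.+ a) 0 (coprime-sym (1-coprimeTo a)))
                                       (mkℚ (ℤ.+ b) 0 (coprime-sym (1-coprimeTo b))))
                          (*≡* (cong (ℤ._* ℤ.+ 1) (sym (pos-* a b)))))

ℕtoℚ-homo-^ : ∀ q k → ℕtoℚ q ^ℚ k ≡ ℕtoℚ (q ℕ.^ k)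
ℕtoℚ-homo-^ q zero    = refl
ℕtoℚ-homo-^ q (suc k) = trans (cong (ℕtoℚ q *_) (ℕtoℚ-homo-^ q k)) (ℕtoℚ-homo-* q (q ℕ.^ k))

-- normalize 1 (suc d) is literally the reciprocal of the normal form of suc d.
ℕtoℚ-*-normalize-1 : ∀ m .{{_ : NonZero m}} → ℕtoℚ m * normalize 1 m ≡ 1ℚ
ℕtoℚ-*-normalize-1 (suc d) =
  trans (cong₂ _*_ (ℕtoℚ≡mkℚ (suc d)) (normalize-coprime (1-coprimeTo (suc d))))
        (*-inverseʳ (mkℚ (ℤ.+ suc d) 0 (coprime-sym (1-coprimeTo (suc d)))))

^ℚ-*-qinv : ∀ q .{{_ : NonZero q}} k → (ℕtoℚ q ^ℚ k) * qinv q k ≡ 1ℚ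
^ℚ-*-qinv q k =
  trans (cong (_* qinv q k) (ℕtoℚ-homo-^ q k)) (ℕtoℚ-*-normalize-1 (q ℕ.^ k) {{m^n≢0 q k}})

sumℚ-++ : ∀ xs ys → sumℚ (xs ++ ys) ≡ sumℚ xs +ℚ sumℚ ys
sumℚ-++ []       ys = sym (+-identityˡ (sumℚ ys))
sumℚ-++ (x ∷ xs) ys = trans (cong (x +ℚ_) (sumℚ-++ xs ys)) (sym (+-assoc x (sumℚ xs) (sumℚ ys)))

sumℚ-upTo-suc : ∀ (h : ℕ → ℚ) L → sumℚ (map h (upTo (suc L))) ≡ sumℚ (map h (upTo L)) +ℚ h L
sumℚ-upTo-suc h L = begin
  sumℚ (map h (upTo (suc L)))             ≡⟨ cong (sumℚ ∘ map h) (sym (upTo-∷ʳ L)) ⟩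
  sumℚ (map h (upTo L ++ [ L ]))          ≡⟨ cong sumℚ (map-++ h (upTo L) [ L ]) ⟩
  sumℚ (map h (upTo L) ++ [ h L ])        ≡⟨ sumℚ-++ (map h (upTo L)) [ h L ] ⟩
  sumℚ (map h (upTo L)) +ℚ (h L +ℚ 0ℚ)    ≡⟨ cong (sumℚ (map h (upTo L)) +ℚ_) (+-identityʳ (h L)) ⟩
  sumℚ (map h (upTo L)) +ℚ h L            ∎

sumℚ-map-*-const : ∀ {a} {X : Set a} (f h : X → ℚ) {c} {ys : List X} → All (λ x → h x ≡ c) ys →
                   sumℚ (map (λ x → f x * h x) ys) ≡ sumℚ (map f ys) * c
sumℚ-map-*-const f h {c} [] = sym (*-zeroˡ c)
sumℚ-map-*-const f h {c} {y ∷ ys} (hy≡c ∷ hys≡c) = begin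
  f y * h y +ℚ sumℚ (map (λ x → f x * h x) ys)  ≡⟨ cong₂ (λ u v → f y * u +ℚ v) hy≡c (sumℚ-map-*-const f h hys≡c) ⟩
  f y * c +ℚ sumℚ (map f ys) * c                ≡⟨ sym (*-distribʳ-+ c (f y) (sumℚ (map f ys))) ⟩
  (f y +ℚ sumℚ (map f ys)) * c                  ∎

module Graded {a} {X : Set a} (s : X → ℕ) where

  below : ℕ → List X → List X
  below δ = filter (λ x → s x ≤? δ)

  at : ℕ → List X → List X
  at k = filter (λ x → s x ≟ k)

  sum-below-suc : ∀ (f : X → ℚ) δ xs →
    sumℚ (map f (below (suc δ) xs)) ≡ sumℚ (map f (below δ xs)) +ℚ sumℚ (map f (at (suc δ) xs))
  sum-below-suc f δ [] = refl
  sum-below-suc f δ (x ∷ xs) with <-cmp (s x) (suc δ)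
  ... | tri< sx<δ+1 _ _
    rewrite filter-accept (λ x → s x ≤? suc δ) {x} {xs} (<⇒≤ sx<δ+1)
          | filter-accept (λ x → s x ≤? δ) {x} {xs} (≤-pred sx<δ+1)
          | filter-reject (λ x → s x ≟ suc δ) {x} {xs} (<⇒≢ sx<δ+1)
    = trans (cong (f x +ℚ_) (sum-below-suc f δ xs)) (sym (+-assoc (f x) _ _))
  ... | tri≈ _ sx≡δ+1 _
    rewrite filter-accept (λ x → s x ≤? suc δ) {x} {xs} (≤-reflexive sx≡δ+1)
          | filter-reject (λ x → s x ≤? δ) {x} {xs} (λ sx≤δ → ≤⇒≯ sx≤δ (≤-reflexive (sym sx≡δ+1)))
          | filter-accept (λ x → s x ≟ suc δ) {x} {xs} sx≡δ+1
    = trans (cong (f x +ℚ_) (sum-below-suc f δ xs))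
            (solve 3 (λ u v w → u :+ (v :+ w) := v :+ (u :+ w)) refl (f x) (sumℚ (map f (below δ xs))) (sumℚ (map f (at (suc δ) xs))))
  ... | tri> _ _ sx>δ+1
    rewrite filter-reject (λ x → s x ≤? suc δ) {x} {xs} (<⇒≱ sx>δ+1)
          | filter-reject (λ x → s x ≤? δ) {x} {xs} (<⇒≱ (<-trans (n<1+n δ) sx>δ+1))
          | filter-reject (λ x → s x ≟ suc δ) {x} {xs} (>⇒≢ sx>δ+1)
    = sum-below-suc f δ xs

  all-at : ∀ k xs → All (λ x → s x ≡ k) (at k xs)
  all-at k = all-filter (λ x → s x ≟ k)

  all-below-zero : ∀ xs → All (λ x → s x ≡ 0) (below 0 xs)
  all-below-zero xs = All.map n≤0⇒n≡0 (all-filter (λ x → s x ≤? 0) xs)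

module _ (q : ℕ) .{{_ : NonZero q}} {n : ℕ} (r : Vec ℕ n) where
  open Graded (σ r)

  sign : Subset n → ℚ
  sign I = (- 1ℚ) ^ℚ ∣ I ∣

  level : ℕ → ℚ
  level k = sumℚ (map sign (at k (subsets n)))

  signSum-suc : ∀ δ → signSum r (suc δ) ≡ signSum r δ +ℚ level (suc δ)
  signSum-suc δ = sum-below-suc sign δ (subsets n)

  φ-zero : φ q 0 r ≡ signSum r 0
  φ-zero = trans (sumℚ-map-*-const sign (qinv q ∘ σ r) (All.map (cong (qinv q)) (all-below-zero (subsets n))))
                 (*-identityʳ (signSum r 0))

  φ-suc : ∀ δ → let Q = ℕtoℚ q ^ℚ suc δ in Q * φ q (suc δ) r ≡ Q * φ q δ r +ℚ level (suc δ)
  φ-suc δ = begin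
    Q * φ q (suc δ) r                                 ≡⟨ cong (Q *_) (sum-below-suc weighted δ (subsets n)) ⟩
    Q * (φ q δ r +ℚ sumℚ (map weighted (at (suc δ) (subsets n))))
      ≡⟨ cong (λ t → Q * (φ q δ r +ℚ t)) (sumℚ-map-*-const sign (qinv q ∘ σ r) (All.map (cong (qinv q)) (all-at (suc δ) (subsets n)))) ⟩
    Q * (φ q δ r +ℚ level (suc δ) * qinv q (suc δ))
      ≡⟨ solve 4 (λ Q f l q⁻ → Q :* (f :+ l :* q⁻) := Q :* f :+ l :* (Q :* q⁻)) refl Q (φ q δ r) (level (suc δ)) (qinv q (suc δ)) ⟩
    Q * φ q δ r +ℚ level (suc δ) * (Q * qinv q (suc δ))  ≡⟨ cong (λ t → Q * φ q δ r +ℚ level (suc δ) * t) (^ℚ-*-qinv q (suc δ)) ⟩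
    Q * φ q δ r +ℚ level (suc δ) * 1ℚ                    ≡⟨ cong (Q * φ q δ r +ℚ_) (*-identityʳ (level (suc δ))) ⟩
    Q * φ q δ r +ℚ level (suc δ)                         ∎
    where
      Q = ℕtoℚ q ^ℚ suc δ
      weighted : Subset n → ℚ
      weighted I = sign I * qinv q (σ r I)

  Φ-telescopes : ∀ L →
    (- ((ℕtoℚ q ^ℚ L) * φ q L r)) +ℚ ((ℕtoℚ q - 1ℚ) * sumℚ (map (λ l → (ℕtoℚ q ^ℚ l) * φ q l r) (upTo L)))
    ≡ - signSum r L
  Φ-telescopes zero = begin
    (- (1ℚ * φ q 0 r)) +ℚ (ℕtoℚ q - 1ℚ) * 0ℚ  ≡⟨ cong (λ t → (- (1ℚ * t)) +ℚ (ℕtoℚ q - 1ℚ) * 0ℚ) φ-zero ⟩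
    (- (1ℚ * signSum r 0)) +ℚ (ℕtoℚ q - 1ℚ) * 0ℚ
      ≡⟨ solve 2 (λ t Q → (:- (con 1ℚ :* t)) :+ (Q :- con 1ℚ) :* con 0ℚ := :- t) refl (signSum r 0) (ℕtoℚ q) ⟩
    - signSum r 0                             ∎
  Φ-telescopes (suc L) = begin
    (- (Q * P * φ₁)) +ℚ (Q - 1ℚ) * sumℚ (map h (upTo (suc L)))  ≡⟨ cong (λ t → (- (Q * P * φ₁)) +ℚ (Q - 1ℚ) * t) (sumℚ-upTo-suc h L) ⟩
    (- (Q * P * φ₁)) +ℚ (Q - 1ℚ) * (S +ℚ P * φ₀)
      ≡⟨ solve 5 (λ Q P φ₁ φ₀ S → (:- (Q :* P :* φ₁)) :+ (Q :- con 1ℚ) :* (S :+ P :* φ₀)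
                                 := ((:- (P :* φ₀)) :+ (Q :- con 1ℚ) :* S) :- (Q :* P :* φ₁ :- Q :* P :* φ₀))
               refl Q P φ₁ φ₀ S ⟩
    ((- (P * φ₀)) +ℚ (Q - 1ℚ) * S) - (Q * P * φ₁ - Q * P * φ₀)
      ≡⟨ cong₂ _-_ (Φ-telescopes L) (cong (_- Q * P * φ₀) (φ-suc L)) ⟩
    (- signSum r L) - (Q * P * φ₀ +ℚ level (suc L) - Q * P * φ₀)
      ≡⟨ solve 3 (λ t z l → (:- t) :- (z :+ l :- z) := :- (t :+ l)) refl (signSum r L) (Q * P * φ₀) (level (suc L)) ⟩
    - (signSum r L +ℚ level (suc L))          ≡⟨ cong -_ (sym (signSum-suc L)) ⟩
    - signSum r (suc L)                       ∎
    where
      Q = ℕtoℚ q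
      P = Q ^ℚ L
      h = λ l → (Q ^ℚ l) * φ q l r
      φ₀ = φ q L r
      φ₁ = φ q (suc L) r
      S = sumℚ (map h (upTo L))

lemma3p2 : (q : ℕ) .{{_ : NonZero q}} → OddPrimePower q →
    (n : ℕ) → n ≥ 1 → (r : Vec ℕ n) → (∀ (j : Fin n) → 1 ≤ lookup r j) →
    (β : ℕ) → ¬ (2 ∣ β) → 2 ∣ total r → β + 2 ≤ total r →
    Φ q β r ≡ - signSum r (Lof β r)
lemma3p2 q _ n _ r _ β _ _ _ = Φ-telescopes q r (Lof β r)
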